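{- Let $G$ be a group and let $\mathbf g=(\mathbf g_1,\dots,\mathbf g_u)\in G^r$ be a juxtaposition of tuples $\mathbf g_i$ such that the product of the entries of $\mathbf g_i$ is 1 for all but possibly one index $i_0\in\{1,\dots,u\}$. Let $\tau_i\in\langle\mathbf g_i\rangle$ (the group generated by the entries of $\mathbf g_i$), $i=1,\dots,u$. Then for any $\pi\in S_u$ there exists $Q\in B_r$ with $(\mathbf g)Q=(\mathbf g_{(1)\pi},\dots,\mathbf g_{(u)\pi})$. Also, for any $i$ and $j$ (with $j\ne i_0$ if $i_0$ exists), there exists $Q\in B_r$ with $(\mathbf g)Q=(\mathbf g_1,\dots,\mathbf g_{j-1},\tau_i\mathbf g_j\tau_i^{ -1},\mathbf g_{j+1},\dots,\mathbf g_u)$, where $\tau_i\mathbf g_j\tau_i^{ -1}$ means entrywise conjugation.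
   Context: The braid group $B_r$ with generators $Q_1,\dots,Q_{r-1}$ acts on the right on $G^r$ by $(\mathbf g)Q_i=(g_1,\dots,g_{i-1},g_ig_{i+1}g_i^{ -1},g_i,g_{i+2},\dots,g_r)$. Permutations in $S_u$ act on the right of integers. -}

module Defs where

open import Level using (Level)
open import Algebra.Bundles using (Group)
open import Data.Nat using (ℕ; zero; suc; _<_)
open import Data.Bool using (Bool; true; false)
open import Data.List using (List; []; _∷_; foldr; concat; map)
open import Data.List.Membership.Propositional using (_∈_)
open import Data.List.Relation.Unary.All using (All)
open import Data.List.Relation.Binary.Pointwise using (Pointwise)
open import Data.Vec using (Vec; toList; lookup; tabulate; _[_]≔_)
open import Data.Fin using (Fin)
open import Data.Fin.Permutation using (Permutation′; _⟨$⟩ʳ_)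
open import Data.Maybe using (Maybe; just)
open import Relation.Binary.PropositionalEquality using (_≡_)

-- A letter of a braid word: Q (suc k) or its inverse, k 0-based:
-- 'gen k true' is Q_{k+1}, 'gen k false' is Q_{k+1}^{-1}; it acts on
-- positions k, k+1 (0-based).
data BraidLetter : Set where
  gen : ℕ → Bool → BraidLetter

letterIndex : BraidLetter → ℕ
letterIndex (gen k _) = k

InBraidGroup : ℕ → List BraidLetter → Set
InBraidGroup r w = All (λ l → suc (letterIndex l) < r) w

module _ {c ℓ : Level} (G : Group c ℓ) where
  open Group G

  actLetter : List Carrier → BraidLetter → List Carrier
  actLetter (x ∷ y ∷ rest) (gen zero true)  = (x ∙ y ∙ x ⁻¹) ∷ x ∷ rest
  actLetter (a ∷ b ∷ rest) (gen zero false) = b ∷ (b ⁻¹ ∙ a ∙ b) ∷ rest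
  actLetter (x ∷ rest) (gen (suc k) s) = x ∷ actLetter rest (gen k s)
  actLetter xs _ = xs

  actWord : List Carrier → List BraidLetter → List Carrier
  actWord g [] = g
  actWord g (l ∷ w) = actWord (actLetter g l) w

  prod : List Carrier → Carrier
  prod = foldr _∙_ ε

  data ⟨_⟩ (S : List Carrier) : Carrier → Set (c Level.⊔ ℓ) where
    gen∈ : ∀ {x} → x ∈ S → ⟨ S ⟩ x
    unit : ⟨ S ⟩ ε
    mul  : ∀ {x y} → ⟨ S ⟩ x → ⟨ S ⟩ y → ⟨ S ⟩ (x ∙ y)
    inv  : ∀ {x} → ⟨ S ⟩ x → ⟨ S ⟩ (x ⁻¹)
    resp : ∀ {x y} → x ≈ y → ⟨ S ⟩ x → ⟨ S ⟩ y

  _≋_ : List Carrier → List Carrier → Set (c Level.⊔ ℓ)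
  _≋_ = Pointwise _≈_

  juxt : ∀ {u} → Vec (List Carrier) u → List Carrier
  juxt gs = concat (toList gs)

  conjTuple : Carrier → List Carrier → List Carrier
  conjTuple τ = map (λ x → τ ∙ x ∙ τ ⁻¹)

  permBlocks : ∀ {u} → Permutation′ u → Vec (List Carrier) u → Vec (List Carrier) u
  permBlocks π gs = tabulate (λ i → lookup gs (π ⟨$⟩ʳ i))

  conjBlock : ∀ {u} → Vec (List Carrier) u → Fin u → Carrier → Vec (List Carrier) u
  conjBlock gs j τ = gs [ j ]≔ conjTuple τ (lookup gs j)

{-# OPTIONS --safe #-}
-- Everything rests on one Hurwitz move: a tuple B pulled leftwards past a
-- tuple A comes out conjugated by the product of A.  So a block of product one
-- passes any other block unchanged, and the blocks can be permuted as soon as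
-- at most one of them has product different from 1.  A product-one block B
-- that passes an entry x and comes back returns conjugated by x, and an entry x
-- of a product-one block g carried once cyclically around g conjugates g by x.
-- The conjugators realisable in these ways form a subgroup, hence contain the
-- subgroup generated by the entries.
module Submission where

open import Defs hiding (_≋_)
open import Algebra.Bundles using (Group)
open import Data.Nat using (ℕ; zero; suc; s≤s; z≤n)
open import Data.Bool using (true; false; not)
open import Data.Sum using (_⊎_; inj₁; inj₂)
open import Data.Product using (_×_; _,_; ∃-syntax)
open import Data.List using (List; []; _∷_; _++_; [_]; length; map)
open import Data.List.Properties using (++-assoc; map-++)
open import Data.List.Relation.Unary.All using ([]; _∷_)
open import Data.List.Relation.Unary.All.Properties using () renaming (++⁺ to All-++⁺)
open import Data.List.Relation.Binary.Pointwise using (Pointwise-length; []; _∷_)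
open import Data.List.Membership.Propositional using (_∈_)
open import Data.List.Membership.Propositional.Properties using (∈-∃++; ∈-map⁺)
open import Data.Vec using (Vec; []; _∷_; lookup; removeAt; _[_]≔_)
open import Data.Vec.Properties using (removeAt-punchOut; lookup∘updateAt; tabulate-cong)
open import Data.Fin using (Fin; zero; suc; punchIn; punchOut; _≟_)
open import Data.Fin.Properties using (punchIn-injective; punchInᵢ≢i; punchOut-punchIn; suc-injective)
open import Data.Fin.Permutation using (Permutation′; _⟨$⟩ʳ_; remove; punchIn-permute)
open import Data.Maybe using (Maybe; just; nothing)
open import Data.Maybe.Properties using (just-injective)
open import Function using (_∘_)
open import Level using (_⊔_)
open import Relation.Binary.Definitions using (Trans)
open import Relation.Binary.PropositionalEquality as ≡ using (_≡_; _≢_; cong; cong₂)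
open import Relation.Binary.Reasoning.Syntax using (module ≋-syntax)
open import Relation.Nullary using (yes; no)
open import Relation.Unary using (Pred)
import Relation.Binary.Reasoning.Base.Single as SingleReasoning
import Relation.Binary.Reasoning.Setoid as SetoidReasoning

lookup-removeAt : ∀ {a} {A : Set a} {n} (xs : Vec A (suc n)) i j →
                  lookup (removeAt xs i) j ≡ lookup xs (punchIn i j)
lookup-removeAt xs i j = ≡.trans (cong (lookup (removeAt xs i)) (≡.sym (punchOut-punchIn i)))
                                 (removeAt-punchOut xs (punchInᵢ≢i i j ∘ ≡.sym))

removeAt-[]≔ : ∀ {a} {A : Set a} {n} (xs : Vec A (suc n)) i y →
               removeAt (xs [ i ]≔ y) i ≡ removeAt xs i
removeAt-[]≔ (x ∷ xs) zero y = ≡.refl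
removeAt-[]≔ (x ∷ x′ ∷ xs) (suc zero) y = ≡.refl
removeAt-[]≔ (x ∷ x′ ∷ x″ ∷ xs) (suc (suc i)) y =
  cong (x ∷_) (removeAt-[]≔ (x′ ∷ x″ ∷ xs) (suc i) y)

shift : BraidLetter → BraidLetter
shift (gen k s) = gen (suc k) s

letter⁻¹ : BraidLetter → BraidLetter
letter⁻¹ (gen k s) = gen k (not s)

word⁻¹ : List BraidLetter → List BraidLetter
word⁻¹ [] = []
word⁻¹ (l ∷ w) = word⁻¹ w ++ [ letter⁻¹ l ]

shift-inBraidGroup : ∀ {r} w → InBraidGroup r w → InBraidGroup (suc r) (map shift w)
shift-inBraidGroup [] [] = []
shift-inBraidGroup (gen k s ∷ w) (p ∷ ps) = s≤s p ∷ shift-inBraidGroup w ps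

word⁻¹-inBraidGroup : ∀ {r} w → InBraidGroup r w → InBraidGroup r (word⁻¹ w)
word⁻¹-inBraidGroup [] [] = []
word⁻¹-inBraidGroup (gen k s ∷ w) (p ∷ ps) = All-++⁺ (word⁻¹-inBraidGroup w ps) (p ∷ [])

module _ {c ℓ} (G : Group c ℓ) where
  open Group G
  open import Algebra.Properties.Group G using (ε⁻¹≈ε; ⁻¹-anti-homo-∙; ⁻¹-involutive)
  open import Algebra.Properties.Monoid monoid using (cancelˡ; cancelʳ)
  open import Data.List.Relation.Binary.Equality.Setoid setoid using (_≋_; ≋-refl; ≋-sym; ≋-trans)
  import Data.List.Relation.Binary.Equality.Setoid setoid as ≋
  private
    module ≈-Reasoning = SetoidReasoning setoid

  _∈⟨_⟩ : Carrier → List Carrier → Set (c ⊔ ℓ)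
  x ∈⟨ S ⟩ = ⟨_⟩ G S x

  record IsSubgroup {p} (P : Pred Carrier p) : Set (c ⊔ ℓ ⊔ p) where
    field
      ε-closed  : P ε
      ∙-closed  : ∀ {x y} → P x → P y → P (x ∙ y)
      ⁻¹-closed : ∀ {x} → P x → P (x ⁻¹)
      ≈-closed  : ∀ {x y} → x ≈ y → P x → P y

  module _ {p} {P : Pred Carrier p} (P-sub : IsSubgroup P) {S} (S⊆P : ∀ {x} → x ∈ S → P x) where
    open IsSubgroup P-sub

    ⟨⟩-least : ∀ {τ} → τ ∈⟨ S ⟩ → P τ
    ⟨⟩-least (gen∈ x∈S) = S⊆P x∈S
    ⟨⟩-least unit = ε-closed
    ⟨⟩-least (mul x∈ y∈) = ∙-closed (⟨⟩-least x∈) (⟨⟩-least y∈)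
    ⟨⟩-least (inv x∈) = ⁻¹-closed (⟨⟩-least x∈)
    ⟨⟩-least (resp x≈y x∈) = ≈-closed x≈y (⟨⟩-least x∈)

  conj : Carrier → Carrier → Carrier
  conj t x = t ∙ x ∙ t ⁻¹

  conj-cong : ∀ {s t x y} → s ≈ t → x ≈ y → conj s x ≈ conj t y
  conj-cong s≈t x≈y = ∙-cong (∙-cong s≈t x≈y) (⁻¹-cong s≈t)

  conj-identityˡ : ∀ x → conj ε x ≈ x
  conj-identityˡ x = trans (∙-cong (identityˡ x) ε⁻¹≈ε) (identityʳ x)

  conj-ε : ∀ t → conj t ε ≈ ε
  conj-ε t = trans (∙-congʳ (identityʳ t)) (inverseʳ t)

  conj-self : ∀ x → conj x x ≈ x
  conj-self x = cancelʳ (inverseʳ x) x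

  conj-inverse-self : ∀ x → conj (x ⁻¹) x ≈ x
  conj-inverse-self x = trans (∙-cong (inverseˡ x) (⁻¹-involutive x)) (identityˡ x)

  conj-∙ : ∀ s t x → conj s (conj t x) ≈ conj (s ∙ t) x
  conj-∙ s t x = begin
    s ∙ (t ∙ x ∙ t ⁻¹) ∙ s ⁻¹    ≈⟨ ∙-congʳ (assoc s (t ∙ x) (t ⁻¹)) ⟨
    s ∙ (t ∙ x) ∙ t ⁻¹ ∙ s ⁻¹    ≈⟨ assoc _ _ _ ⟩
    s ∙ (t ∙ x) ∙ (t ⁻¹ ∙ s ⁻¹)  ≈⟨ ∙-cong (assoc s t x) (⁻¹-anti-homo-∙ s t) ⟨
    s ∙ t ∙ x ∙ (s ∙ t) ⁻¹       ∎
    where open ≈-Reasoning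

  conj-homo-∙ : ∀ t x y → conj t (x ∙ y) ≈ conj t x ∙ conj t y
  conj-homo-∙ t x y = begin
    t ∙ (x ∙ y) ∙ t ⁻¹                  ≈⟨ ∙-congʳ (assoc t x y) ⟨
    t ∙ x ∙ y ∙ t ⁻¹                    ≈⟨ assoc _ _ _ ⟩
    t ∙ x ∙ (y ∙ t ⁻¹)                  ≈⟨ ∙-congˡ (∙-congʳ (cancelˡ (inverseˡ t) y)) ⟨
    t ∙ x ∙ (t ⁻¹ ∙ (t ∙ y) ∙ t ⁻¹)     ≈⟨ ∙-congˡ (assoc _ _ _) ⟩
    t ∙ x ∙ (t ⁻¹ ∙ (t ∙ y ∙ t ⁻¹))     ≈⟨ assoc _ _ _ ⟨
    t ∙ x ∙ t ⁻¹ ∙ (t ∙ y ∙ t ⁻¹)       ∎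
    where open ≈-Reasoning

  -- The two identities making Q_i⁻¹ undo Q_i.
  ⁻¹-conj-∙ : ∀ x y → x ⁻¹ ∙ conj x y ∙ x ≈ y
  ⁻¹-conj-∙ x y = begin
    x ⁻¹ ∙ (x ∙ y ∙ x ⁻¹) ∙ x    ≈⟨ ∙-congʳ (assoc (x ⁻¹) (x ∙ y) (x ⁻¹)) ⟨
    x ⁻¹ ∙ (x ∙ y) ∙ x ⁻¹ ∙ x    ≈⟨ cancelʳ (inverseˡ x) _ ⟩
    x ⁻¹ ∙ (x ∙ y)               ≈⟨ cancelˡ (inverseˡ x) y ⟩
    y                            ∎
    where open ≈-Reasoning

  conj-⁻¹-∙ : ∀ x y → conj x (x ⁻¹ ∙ y ∙ x) ≈ y
  conj-⁻¹-∙ x y = begin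
    x ∙ (x ⁻¹ ∙ y ∙ x) ∙ x ⁻¹    ≈⟨ ∙-congʳ (assoc x (x ⁻¹ ∙ y) x) ⟨
    x ∙ (x ⁻¹ ∙ y) ∙ x ∙ x ⁻¹    ≈⟨ cancelʳ (inverseʳ x) _ ⟩
    x ∙ (x ⁻¹ ∙ y)               ≈⟨ cancelˡ (inverseʳ x) y ⟩
    y                            ∎
    where open ≈-Reasoning

  record ProductOne (xs : List Carrier) : Set ℓ where
    constructor productOne
    field prod≈ε : prod G xs ≈ ε

  prod-++ : ∀ xs ys → prod G (xs ++ ys) ≈ prod G xs ∙ prod G ys
  prod-++ [] ys = sym (identityˡ _)
  prod-++ (x ∷ xs) ys = trans (∙-congˡ (prod-++ xs ys)) (sym (assoc _ _ _))

  prod-conjTuple : ∀ t xs → prod G (conjTuple G t xs) ≈ conj t (prod G xs)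
  prod-conjTuple t [] = sym (conj-ε t)
  prod-conjTuple t (x ∷ xs) = trans (∙-congˡ (prod-conjTuple t xs)) (sym (conj-homo-∙ t x (prod G xs)))

  conjTuple-productOne : ∀ t {xs} → ProductOne xs → ProductOne (conjTuple G t xs)
  conjTuple-productOne t {xs} (productOne p) =
    productOne (trans (prod-conjTuple t xs) (trans (conj-cong refl p) (conj-ε t)))

  conjTuple-cong : ∀ {s t} → s ≈ t → ∀ xs → conjTuple G s xs ≋ conjTuple G t xs
  conjTuple-cong s≈t [] = []
  conjTuple-cong s≈t (x ∷ xs) = conj-cong s≈t refl ∷ conjTuple-cong s≈t xs

  conjTuple-identity : ∀ xs → conjTuple G ε xs ≋ xs
  conjTuple-identity [] = []
  conjTuple-identity (x ∷ xs) = conj-identityˡ x ∷ conjTuple-identity xs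

  conjTuple-∙ : ∀ s t xs → conjTuple G s (conjTuple G t xs) ≋ conjTuple G (s ∙ t) xs
  conjTuple-∙ s t [] = []
  conjTuple-∙ s t (x ∷ xs) = conj-∙ s t x ∷ conjTuple-∙ s t xs

  prod-conjTuple-suffix : ∀ xs ys {x} → ProductOne (xs ++ x ∷ ys) →
                          prod G (xs ++ conjTuple G x ys) ≈ x ⁻¹
  prod-conjTuple-suffix xs ys {x} (productOne p) = begin
    prod G (xs ++ conjTuple G x ys)     ≈⟨ prod-++ xs (conjTuple G x ys) ⟩
    prod G xs ∙ prod G (conjTuple G x ys) ≈⟨ ∙-congˡ (prod-conjTuple x ys) ⟩
    prod G xs ∙ (x ∙ prod G ys ∙ x ⁻¹)  ≈⟨ assoc _ _ _ ⟨
    prod G xs ∙ (x ∙ prod G ys) ∙ x ⁻¹  ≈⟨ ∙-congʳ (trans (sym (prod-++ xs (x ∷ ys))) p) ⟩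
    ε ∙ x ⁻¹                            ≈⟨ identityˡ _ ⟩
    x ⁻¹                                ∎
    where open ≈-Reasoning

  conjTuple-inverseʳ : ∀ x xs → conjTuple G x (conjTuple G (x ⁻¹) xs) ≋ xs
  conjTuple-inverseʳ x xs =
    ≋-trans (conjTuple-∙ x (x ⁻¹) xs)
            (≋-trans (conjTuple-cong (inverseʳ x) xs) (conjTuple-identity xs))

  actLetter-∷ : ∀ x xs k s → actLetter G (x ∷ xs) (gen (suc k) s) ≡ x ∷ actLetter G xs (gen k s)
  actLetter-∷ x [] k s = ≡.refl
  actLetter-∷ x (y ∷ xs) k s = ≡.refl

  actLetter-length : ∀ xs l → length (actLetter G xs l) ≡ length xs
  actLetter-length [] l = ≡.refl
  actLetter-length (x ∷ []) (gen zero s) = ≡.refl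
  actLetter-length (x ∷ []) (gen (suc k) s) = ≡.refl
  actLetter-length (x ∷ y ∷ xs) (gen zero true) = ≡.refl
  actLetter-length (x ∷ y ∷ xs) (gen zero false) = ≡.refl
  actLetter-length (x ∷ y ∷ xs) (gen (suc k) s) = cong suc (actLetter-length (y ∷ xs) (gen k s))

  actWord-length : ∀ xs w → length (actWord G xs w) ≡ length xs
  actWord-length xs [] = ≡.refl
  actWord-length xs (l ∷ w) = ≡.trans (actWord-length (actLetter G xs l) w) (actLetter-length xs l)

  actLetter-cong : ∀ {xs ys} → xs ≋ ys → ∀ l → actLetter G xs l ≋ actLetter G ys l
  actLetter-cong [] l = []
  actLetter-cong (p ∷ []) (gen zero s) = p ∷ []
  actLetter-cong (p ∷ []) (gen (suc k) s) = p ∷ []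
  actLetter-cong (p ∷ q ∷ ps) (gen zero true) = conj-cong p q ∷ p ∷ ps
  actLetter-cong (p ∷ q ∷ ps) (gen zero false) = q ∷ ∙-cong (∙-cong (⁻¹-cong q) p) q ∷ ps
  actLetter-cong (p ∷ q ∷ ps) (gen (suc k) s) = p ∷ actLetter-cong (q ∷ ps) (gen k s)

  actWord-cong : ∀ {xs ys} → xs ≋ ys → ∀ w → actWord G xs w ≋ actWord G ys w
  actWord-cong p [] = p
  actWord-cong p (l ∷ w) = actWord-cong (actLetter-cong p l) w

  actWord-++ : ∀ xs w w′ → actWord G xs (w ++ w′) ≡ actWord G (actWord G xs w) w′
  actWord-++ xs [] w′ = ≡.refl
  actWord-++ xs (l ∷ w) w′ = actWord-++ (actLetter G xs l) w w′

  actLetter-inverse : ∀ xs l → actLetter G (actLetter G xs l) (letter⁻¹ l) ≋ xs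
  actLetter-inverse [] (gen k s) = []
  actLetter-inverse (x ∷ []) (gen zero s) = refl ∷ []
  actLetter-inverse (x ∷ []) (gen (suc k) s) = refl ∷ []
  actLetter-inverse (x ∷ y ∷ xs) (gen zero true) = refl ∷ ⁻¹-conj-∙ x y ∷ ≋-refl
  actLetter-inverse (x ∷ y ∷ xs) (gen zero false) = conj-⁻¹-∙ y x ∷ refl ∷ ≋-refl
  actLetter-inverse (x ∷ y ∷ xs) (gen (suc k) s) =
    ≡.subst (_≋ x ∷ y ∷ xs) (≡.sym (actLetter-∷ x (actLetter G (y ∷ xs) (gen k s)) k (not s)))
      (refl ∷ actLetter-inverse (y ∷ xs) (gen k s))

  actWord-inverse : ∀ xs w → actWord G (actWord G xs w) (word⁻¹ w) ≋ xs
  actWord-inverse xs [] = ≋-refl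
  actWord-inverse xs (l ∷ w)
    rewrite actWord-++ (actWord G (actLetter G xs l) w) (word⁻¹ w) [ letter⁻¹ l ] =
    ≋-trans (actLetter-cong (actWord-inverse (actLetter G xs l) w) (letter⁻¹ l)) (actLetter-inverse xs l)

  actWord-shift : ∀ x xs w → actWord G (x ∷ xs) (map shift w) ≡ x ∷ actWord G xs w
  actWord-shift x xs [] = ≡.refl
  actWord-shift x xs (gen k s ∷ w) rewrite actLetter-∷ x xs k s =
    actWord-shift x (actLetter G xs (gen k s)) w

  infix 4 _∼_
  _∼_ : List Carrier → List Carrier → Set (c ⊔ ℓ)
  xs ∼ ys = ∃[ Q ] (InBraidGroup (length xs) Q × actWord G xs Q ≋ ys)

  ≋⇒∼ : ∀ {xs ys} → xs ≋ ys → xs ∼ ys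
  ≋⇒∼ p = [] , [] , p

  ∼-refl : ∀ {xs} → xs ∼ xs
  ∼-refl = ≋⇒∼ ≋-refl

  ∼⇒length≡ : ∀ {xs ys} → xs ∼ ys → length ys ≡ length xs
  ∼⇒length≡ {xs} (Q , _ , e) = ≡.trans (≡.sym (Pointwise-length e)) (actWord-length xs Q)

  ∼-sym : ∀ {xs ys} → xs ∼ ys → ys ∼ xs
  ∼-sym {xs} xs∼ys@(Q , Q∈B , e) =
    word⁻¹ Q ,
    ≡.subst (λ r → InBraidGroup r (word⁻¹ Q)) (≡.sym (∼⇒length≡ xs∼ys))
            (word⁻¹-inBraidGroup Q Q∈B) ,
    ≋-trans (actWord-cong (≋-sym e) (word⁻¹ Q)) (actWord-inverse xs Q)

  ∼-trans : ∀ {xs ys zs} → xs ∼ ys → ys ∼ zs → xs ∼ zs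
  ∼-trans {xs} xs∼ys@(Q , Q∈B , e) (Q′ , Q′∈B , e′) =
    Q ++ Q′ ,
    All-++⁺ Q∈B (≡.subst (λ r → InBraidGroup r Q′) (∼⇒length≡ xs∼ys) Q′∈B) ,
    ≡.subst (_≋ _) (≡.sym (actWord-++ xs Q Q′)) (≋-trans (actWord-cong e Q′) e′)

  ∼-∷ : ∀ x {xs ys} → xs ∼ ys → x ∷ xs ∼ x ∷ ys
  ∼-∷ x {xs} (Q , Q∈B , e) =
    map shift Q , shift-inBraidGroup Q Q∈B , ≡.subst (_≋ _) (≡.sym (actWord-shift x xs Q)) (refl ∷ e)

  ∼-++⁺ˡ : ∀ zs {xs ys} → xs ∼ ys → zs ++ xs ∼ zs ++ ys
  ∼-++⁺ˡ [] p = p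
  ∼-++⁺ˡ (z ∷ zs) p = ∼-∷ z (∼-++⁺ˡ zs p)

  Q₁ : ∀ x y xs → x ∷ y ∷ xs ∼ conj x y ∷ x ∷ xs
  Q₁ x y xs = [ gen zero true ] , s≤s (s≤s z≤n) ∷ [] , ≋-refl

  module ∼-Reasoning where
    open SingleReasoning _∼_ ∼-refl ∼-trans public

    ≋-go : Trans _≋_ _IsRelatedTo_ _IsRelatedTo_
    ≋-go p = ∼-go (≋⇒∼ p)

    open ≋-syntax _IsRelatedTo_ _IsRelatedTo_ ≋-go ≋-sym public

  conjTuple-cong-∼ : ∀ {s t} → s ≈ t → ∀ xs ys → conjTuple G s xs ++ ys ∼ conjTuple G t xs ++ ys
  conjTuple-cong-∼ s≈t xs ys = ≋⇒∼ (≋.++⁺ʳ ys (conjTuple-cong s≈t xs))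

  pull-entry : ∀ xs y zs → xs ++ y ∷ zs ∼ conj (prod G xs) y ∷ xs ++ zs
  pull-entry [] y zs = ≋⇒∼ (sym (conj-identityˡ y) ∷ ≋-refl)
  pull-entry (x ∷ xs) y zs = begin
    x ∷ xs ++ y ∷ zs                                ∼⟨ ∼-∷ x (pull-entry xs y zs) ⟩
    x ∷ conj (prod G xs) y ∷ xs ++ zs               ∼⟨ Q₁ x _ (xs ++ zs) ⟩
    conj x (conj (prod G xs) y) ∷ x ∷ xs ++ zs      ≋⟨ conj-∙ x (prod G xs) y ∷ ≋-refl ⟩
    conj (x ∙ prod G xs) y ∷ x ∷ xs ++ zs           ∎
    where open ∼-Reasoning

  pull : ∀ xs ys zs → xs ++ ys ++ zs ∼ conjTuple G (prod G xs) ys ++ xs ++ zs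
  pull xs [] zs = ∼-refl
  pull xs (y ∷ ys) zs = ∼-trans (pull-entry xs y (ys ++ zs)) (∼-∷ _ (pull xs ys zs))

  pull-past-entry : ∀ x ys zs → x ∷ ys ++ zs ∼ conjTuple G x ys ++ x ∷ zs
  pull-past-entry x ys zs = ∼-trans (pull [ x ] ys zs) (conjTuple-cong-∼ (identityʳ x) ys (x ∷ zs))

  swap : ∀ xs ys zs → ProductOne xs ⊎ ProductOne ys → xs ++ ys ++ zs ∼ ys ++ xs ++ zs
  swap xs ys zs (inj₁ (productOne p)) = begin
    xs ++ ys ++ zs                          ∼⟨ pull xs ys zs ⟩
    conjTuple G (prod G xs) ys ++ xs ++ zs  ∼⟨ conjTuple-cong-∼ p ys (xs ++ zs) ⟩
    conjTuple G ε ys ++ xs ++ zs            ≋⟨ ≋.++⁺ʳ (xs ++ zs) (conjTuple-identity ys) ⟩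
    ys ++ xs ++ zs                          ∎
    where open ∼-Reasoning
  swap xs ys zs (inj₂ p) = ∼-sym (swap ys xs zs (inj₁ p))

  ∼-across : ∀ {xs ys} → ProductOne xs → ProductOne ys → ∀ us {zs} →
             xs ++ zs ∼ ys ++ zs → xs ++ us ++ zs ∼ ys ++ us ++ zs
  ∼-across {xs} {ys} p q us {zs} r = begin
    xs ++ us ++ zs  ∼⟨ swap xs us zs (inj₁ p) ⟩
    us ++ xs ++ zs  ∼⟨ ∼-++⁺ˡ us r ⟩
    us ++ ys ++ zs  ∼⟨ swap us ys zs (inj₂ q) ⟩
    ys ++ us ++ zs  ∎
    where open ∼-Reasoning

  -- B travels to the right of x and back: first unchanged, then conjugated by x.
  pass-around : ∀ {B} → ProductOne B → ∀ x zs → B ++ x ∷ zs ∼ conjTuple G x B ++ x ∷ zs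
  pass-around {B} p x zs = ∼-trans (swap B [ x ] zs (inj₁ p)) (pull-past-entry x B zs)

  conj-by-own-entry : ∀ {g} → ProductOne g → ∀ {x} → x ∈ g → ∀ zs →
                      g ++ zs ∼ conjTuple G x g ++ zs
  conj-by-own-entry p {x} x∈g zs with ∈-∃++ x∈g
  ... | A , B , ≡.refl = begin
    (A ++ x ∷ B) ++ zs             ≡⟨ ++-assoc A (x ∷ B) zs ⟩
    A ++ x ∷ B ++ zs               ∼⟨ ∼-++⁺ˡ A (pull-past-entry x B zs) ⟩
    A ++ xBx⁻¹ ++ x ∷ zs           ≡⟨ ++-assoc A xBx⁻¹ (x ∷ zs) ⟨
    (A ++ xBx⁻¹) ++ x ∷ zs         ∼⟨ pull-entry (A ++ xBx⁻¹) x zs ⟩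
    conj ρ x ∷ (A ++ xBx⁻¹) ++ zs  ≋⟨ conj-ρ-x ∷ ≋.≋-reflexive (++-assoc A xBx⁻¹ zs) ⟩
    x ∷ A ++ xBx⁻¹ ++ zs           ∼⟨ pull-past-entry x A (xBx⁻¹ ++ zs) ⟩
    xAx⁻¹ ++ x ∷ xBx⁻¹ ++ zs       ≋⟨ ≋.++⁺ˡ xAx⁻¹ (sym (conj-self x) ∷ ≋-refl) ⟩
    xAx⁻¹ ++ conj x x ∷ xBx⁻¹ ++ zs  ≡⟨ ++-assoc xAx⁻¹ (conj x x ∷ xBx⁻¹) zs ⟨
    (xAx⁻¹ ++ conj x x ∷ xBx⁻¹) ++ zs ≡⟨ cong (_++ zs) (map-++ (conj x) A (x ∷ B)) ⟨
    conjTuple G x (A ++ x ∷ B) ++ zs ∎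
    where
    open ∼-Reasoning
    xAx⁻¹ = conjTuple G x A
    xBx⁻¹ = conjTuple G x B
    ρ = prod G (A ++ xBx⁻¹)
    conj-ρ-x : conj ρ x ≈ x
    conj-ρ-x = trans (conj-cong (prod-conjTuple-suffix A B p) refl) (conj-inverse-self x)

  conj-by-own-subgroup : ∀ {g} → ProductOne g → ∀ {τ} → τ ∈⟨ g ⟩ → ∀ zs →
                         g ++ zs ∼ conjTuple G τ g ++ zs
  conj-by-own-subgroup {g} p {τ} τ∈ zs = begin
    g ++ zs                      ≋⟨ ≋.++⁺ʳ zs (conjTuple-identity g) ⟨
    conjTuple G ε g ++ zs        ∼⟨ ⟨⟩-least translations generator τ∈ ε ⟩
    conjTuple G (ε ∙ τ) g ++ zs  ∼⟨ conjTuple-cong-∼ (identityˡ τ) g zs ⟩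
    conjTuple G τ g ++ zs        ∎
    where
    open ∼-Reasoning
    Translation : Pred Carrier (c ⊔ ℓ)
    Translation τ = ∀ σ → conjTuple G σ g ++ zs ∼ conjTuple G (σ ∙ τ) g ++ zs
    translations : IsSubgroup Translation
    translations = record
      { ε-closed  = λ σ → conjTuple-cong-∼ (sym (identityʳ σ)) g zs
      ; ∙-closed  = λ {x} {y} tx ty σ →
          ∼-trans (tx σ) (∼-trans (ty (σ ∙ x)) (conjTuple-cong-∼ (assoc σ x y) g zs))
      ; ⁻¹-closed = λ {x} tx σ →
          ∼-sym (∼-trans (tx (σ ∙ x ⁻¹)) (conjTuple-cong-∼ (cancelʳ (inverseˡ x) σ) g zs))
      ; ≈-closed  = λ x≈y tx σ → ∼-trans (tx σ) (conjTuple-cong-∼ (∙-congˡ x≈y) g zs)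
      }
    -- the entry conj σ x of the conjugated block realises the translation by x
    generator : ∀ {x} → x ∈ g → Translation x
    generator {x} x∈g σ = begin
      conjTuple G σ g ++ zs
        ∼⟨ conj-by-own-entry (conjTuple-productOne σ p) (∈-map⁺ (conj σ) x∈g) zs ⟩
      conjTuple G (conj σ x) (conjTuple G σ g) ++ zs
        ≋⟨ ≋.++⁺ʳ zs (conjTuple-∙ (conj σ x) σ g) ⟩
      conjTuple G (conj σ x ∙ σ) g ++ zs
        ∼⟨ conjTuple-cong-∼ (cancelʳ (inverseˡ σ) (σ ∙ x)) g zs ⟩
      conjTuple G (σ ∙ x) g ++ zs
        ∎

  conj-by-next-entry : ∀ {A x} → x ∈ A → ∀ {B} → ProductOne B → ∀ zs →
                       B ++ A ++ zs ∼ conjTuple G x B ++ A ++ zs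
  conj-by-next-entry {x = x} x∈A {B} p zs with ∈-∃++ x∈A
  ... | A₁ , A₂ , ≡.refl = begin
    B ++ (A₁ ++ x ∷ A₂) ++ zs    ≡⟨ cong (B ++_) (++-assoc A₁ (x ∷ A₂) zs) ⟩
    B ++ A₁ ++ x ∷ A₂ ++ zs      ∼⟨ ∼-across p (conjTuple-productOne x p) A₁ (pass-around p x _) ⟩
    xBx⁻¹ ++ A₁ ++ x ∷ A₂ ++ zs  ≡⟨ cong (xBx⁻¹ ++_) (++-assoc A₁ (x ∷ A₂) zs) ⟨
    xBx⁻¹ ++ (A₁ ++ x ∷ A₂) ++ zs ∎
    where
    open ∼-Reasoning
    xBx⁻¹ = conjTuple G x B

  conj-by-next-subgroup : ∀ {A τ} → τ ∈⟨ A ⟩ → ∀ {B} → ProductOne B → ∀ zs →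
                          B ++ A ++ zs ∼ conjTuple G τ B ++ A ++ zs
  conj-by-next-subgroup {A} τ∈ p zs =
    ⟨⟩-least conjugators (λ x∈A q → conj-by-next-entry x∈A q zs) τ∈ p
    where
    Conjugator : Pred Carrier (c ⊔ ℓ)
    Conjugator τ = ∀ {B} → ProductOne B → B ++ A ++ zs ∼ conjTuple G τ B ++ A ++ zs
    conjugators : IsSubgroup Conjugator
    conjugators = record
      { ε-closed  = λ {B} _ → ≋⇒∼ (≋.++⁺ʳ (A ++ zs) (≋-sym (conjTuple-identity B)))
      ; ∙-closed  = λ {x} {y} cx cy {B} q →
          ∼-trans (cy q) (∼-trans (cx (conjTuple-productOne y q))
                                  (≋⇒∼ (≋.++⁺ʳ (A ++ zs) (conjTuple-∙ x y B))))
      ; ⁻¹-closed = λ {x} cx {B} q →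
          ∼-sym (∼-trans (cx (conjTuple-productOne (x ⁻¹) q))
                         (≋⇒∼ (≋.++⁺ʳ (A ++ zs) (conjTuple-inverseʳ x B))))
      ; ≈-closed  = λ x≈y cx {B} q → ∼-trans (cx q) (conjTuple-cong-∼ x≈y B (A ++ zs))
      }

  conj-by-later-block : ∀ {B} → ProductOne B → ∀ {n} (gs : Vec (List Carrier) n) i {τ} →
                        τ ∈⟨ lookup gs i ⟩ → B ++ juxt G gs ∼ conjTuple G τ B ++ juxt G gs
  conj-by-later-block p (A ∷ gs) zero τ∈ = conj-by-next-subgroup τ∈ p (juxt G gs)
  conj-by-later-block p (A ∷ gs) (suc i) {τ} τ∈ =
    ∼-across p (conjTuple-productOne τ p) A (conj-by-later-block p gs i τ∈)

  bring-to-front : ∀ {n} (gs : Vec (List Carrier) (suc n)) m →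
                   (∀ k → k ≢ m → ProductOne (lookup gs k) ⊎ ProductOne (lookup gs m)) →
                   juxt G gs ∼ lookup gs m ++ juxt G (removeAt gs m)
  bring-to-front (A ∷ gs) zero _ = ∼-refl
  bring-to-front (A ∷ B ∷ gs) (suc m) po = begin
    A ++ juxt G (B ∷ gs)                      ∼⟨ ∼-++⁺ˡ A (bring-to-front (B ∷ gs) m po-tail) ⟩
    A ++ Bₘ ++ juxt G (removeAt (B ∷ gs) m)   ∼⟨ swap A Bₘ _ (po zero λ ()) ⟩
    Bₘ ++ A ++ juxt G (removeAt (B ∷ gs) m)   ∎
    where
    open ∼-Reasoning
    Bₘ = lookup (B ∷ gs) m
    po-tail : ∀ k → k ≢ m → ProductOne (lookup (B ∷ gs) k) ⊎ ProductOne Bₘ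
    po-tail k k≢m = po (suc k) (k≢m ∘ suc-injective)

  update-to-front : ∀ {n} (gs : Vec (List Carrier) (suc n)) m {B} → ProductOne B →
                    juxt G (gs [ m ]≔ B) ∼ B ++ juxt G (removeAt gs m)
  update-to-front gs m {B} p = begin
    juxt G gs′
      ∼⟨ bring-to-front gs′ m (λ _ _ → inj₂ (≡.subst ProductOne (≡.sym updated) p)) ⟩
    lookup gs′ m ++ juxt G (removeAt gs′ m)
      ≡⟨ cong₂ (λ X Y → X ++ juxt G Y) updated (removeAt-[]≔ gs m B) ⟩
    B ++ juxt G (removeAt gs m)
      ∎
    where
    open ∼-Reasoning
    gs′ = gs [ m ]≔ B
    updated : lookup gs′ m ≡ B
    updated = lookup∘updateAt m gs

  conjBlock-∼ : ∀ {n} (gs : Vec (List Carrier) n) i j {τ} → τ ∈⟨ lookup gs i ⟩ →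
                ProductOne (lookup gs j) → juxt G gs ∼ juxt G (conjBlock G gs j τ)
  conjBlock-∼ gs@(_ ∷ _) i j {τ} τ∈ p = begin
    juxt G gs                    ∼⟨ bring-to-front gs j (λ _ _ → inj₂ p) ⟩
    B ++ juxt G rest             ∼⟨ conj-at-front i τ∈ ⟩
    conjTuple G τ B ++ juxt G rest ∼⟨ ∼-sym (update-to-front gs j (conjTuple-productOne τ p)) ⟩
    juxt G (conjBlock G gs j τ)  ∎
    where
    open ∼-Reasoning
    B = lookup gs j
    rest = removeAt gs j
    conj-at-front : ∀ i → τ ∈⟨ lookup gs i ⟩ → B ++ juxt G rest ∼ conjTuple G τ B ++ juxt G rest
    conj-at-front i τ∈ with i ≟ j
    ... | yes ≡.refl = conj-by-own-subgroup p τ∈ _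
    ... | no i≢j = conj-by-later-block p rest (punchOut (i≢j ∘ ≡.sym))
                     (≡.subst (τ ∈⟨_⟩) (≡.sym (removeAt-punchOut gs (i≢j ∘ ≡.sym))) τ∈)

  AtMostOneNontrivial : ∀ {n} → Vec (List Carrier) n → Set ℓ
  AtMostOneNontrivial gs = ∀ a b → a ≢ b → ProductOne (lookup gs a) ⊎ ProductOne (lookup gs b)

  exceptional-index⇒atMostOne : ∀ {n} (gs : Vec (List Carrier) n) (i₀ : Maybe (Fin n)) →
                                (∀ i → just i ≢ i₀ → prod G (lookup gs i) ≈ ε) →
                                AtMostOneNontrivial gs
  exceptional-index⇒atMostOne gs nothing po a b _ = inj₁ (productOne (po a λ ()))
  exceptional-index⇒atMostOne gs (just i₀) po a b a≢b with a ≟ i₀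
  ... | yes ≡.refl = inj₂ (productOne (po b (a≢b ∘ ≡.sym ∘ just-injective)))
  ... | no a≢i₀ = inj₁ (productOne (po a (a≢i₀ ∘ just-injective)))

  removeAt-atMostOne : ∀ {n} (gs : Vec (List Carrier) (suc n)) m →
                       AtMostOneNontrivial gs → AtMostOneNontrivial (removeAt gs m)
  removeAt-atMostOne gs m po a b a≢b
    rewrite lookup-removeAt gs m a | lookup-removeAt gs m b =
    po (punchIn m a) (punchIn m b) (a≢b ∘ punchIn-injective m a b)

  permBlocks-∼ : ∀ {n} (gs : Vec (List Carrier) n) → AtMostOneNontrivial gs →
                 (π : Permutation′ n) → juxt G gs ∼ juxt G (permBlocks G π gs)
  permBlocks-∼ [] _ π = ∼-refl
  permBlocks-∼ gs@(_ ∷ _) po π = begin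
    juxt G gs
      ∼⟨ bring-to-front gs m (λ k k≢m → po k m k≢m) ⟩
    lookup gs m ++ juxt G rest
      ∼⟨ ∼-++⁺ˡ (lookup gs m) (permBlocks-∼ rest (removeAt-atMostOne gs m po) π′) ⟩
    lookup gs m ++ juxt G (permBlocks G π′ rest)
      ≡⟨ cong (λ v → lookup gs m ++ juxt G v) (tabulate-cong remaining) ⟩
    juxt G (permBlocks G π gs)
      ∎
    where
    open ∼-Reasoning
    m = π ⟨$⟩ʳ zero
    π′ = remove zero π
    rest = removeAt gs m
    remaining : ∀ i → lookup rest (π′ ⟨$⟩ʳ i) ≡ lookup gs (π ⟨$⟩ʳ suc i)
    remaining i = ≡.trans (lookup-removeAt gs m (π′ ⟨$⟩ʳ i))
                          (cong (lookup gs) (≡.sym (punchIn-permute π zero i)))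

open Defs using (_≋_)

lemma2p9 : ∀ {c ℓ} (G : Group c ℓ) {u : ℕ} (gs : Vec (List (Group.Carrier G)) u)
             (i₀ : Maybe (Fin u))
             → (∀ (i : Fin u) → just i ≢ i₀ → Group._≈_ G (prod G (lookup gs i)) (Group.ε G))
             → ((π : Permutation′ u) → ∃[ Q ] (InBraidGroup (length (juxt G gs)) Q
                   × _≋_ G (actWord G (juxt G gs) Q) (juxt G (permBlocks G π gs))))
               × ((i j : Fin u) (τ : Group.Carrier G) → ⟨_⟩ G (lookup gs i) τ → just j ≢ i₀
                   → ∃[ Q ] (InBraidGroup (length (juxt G gs)) Q
                   × _≋_ G (actWord G (juxt G gs) Q) (juxt G (conjBlock G gs j τ))))
lemma2p9 G gs i₀ po =
  permBlocks-∼ G gs (exceptional-index⇒atMostOne G gs i₀ po) ,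
  λ i j τ τ∈ j≢i₀ → conjBlock-∼ G gs i j τ∈ (productOne (po j j≢i₀))
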